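{- Let $a=\alpha^s$, $b=\alpha^u$, $c=\alpha^v$ with $s,u,v\in D\setminus\{\frac{(q^2+1)(q+1)}{2}\}$. Let $P_a: ax+a^qy+a^{q^2}z+a^{q^3}t=0$, $P_b: bx+b^qy+b^{q^2}z+b^{q^3}t=0$, $Q_b: bx^2+b^qy^2+b^{q^2}z^2+b^{q^3}t^2=0$, $Q_c: cx^2+c^qy^2+c^{q^2}z^2+c^{q^3}t^2=0$, $R_c: cx^4+c^qy^4+c^{q^2}z^4+c^{q^3}t^4=0$ in $PG(3,q^4)$, and let $\Psi_a$ be the hypersurface $(a\sqrt{x}+a^q\sqrt{y}+a^{q^2}\sqrt{z}+a^{q^3}\sqrt{t})(a\sqrt{x}-a^q\sqrt{y}+a^{q^2}\sqrt{z}-a^{q^3}\sqrt{t})=0$ (membership interpreted as in the context). For $0\le l<\frac{q^2+1}{2}$ and $p_l\in\{0,1\}$, let $p'=\omega((l+p_l\frac{q^2+1}{2})(q+1))$ and $p=\omega(2l(q+1))$. Then: (1) if $p'\in P_a$ then $p\in\Psi_a$; (2) if $p'\in Q_b$ then $p\in P_b$; (3) if $p'\in R_c$ then $p\in Q_c$.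
   Context: $q$ is an odd prime power, $\alpha$ a primitive element of $\mathbb{F}_{q^4}$, $\mathrm{Tr}(a)=a+a^q+a^{q^2}+a^{q^3}$, $D=\{i\in\mathbb{Z}_{(q^2+1)(q+1)}:\mathrm{Tr}(\alpha^i)=0\}$. For an integer $l$, $\omega(l)=(\alpha^l:\alpha^{lq}:\alpha^{lq^2}:\alpha^{lq^3})\in PG(3,q^4)$. For $0\le l<(q^2+1)/2$ the point $\omega(2l(q+1))$ lies on $\Psi_a$ iff the defining product vanishes with $(\sqrt{x},\sqrt{y},\sqrt{z},\sqrt{t})=(\alpha^{l(q+1)},\alpha^{lq(q+1)},\alpha^{lq^2(q+1)},\alpha^{lq^3(q+1)})$, i.e. iff $w+w^q+w^{q^2}+w^{q^3}=0$ or $w-w^q+w^{q^2}-w^{q^3}=0$ with $w=\alpha^{s+l(q+1)}$. -}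

module Defs where

open import Level using (Level)
open import Algebra.Bundles using (CommutativeRing; Semiring)
open import Data.Nat using (ℕ; zero; suc; _<_; _≤_; _∸_) renaming (_^_ to _ℕ^_; _*_ to _ℕ*_; _+_ to _ℕ+_)
open import Data.Nat.Primality using (Prime)
open import Data.Nat.DivMod using (_%_; _/_)
open import Data.Fin using (Fin)
open import Data.Product using (Σ; _×_; _,_; ∃)
open import Data.Sum using (_⊎_)
open import Relation.Nullary using (¬_)
open import Relation.Binary.PropositionalEquality using (_≡_)

OddPrimePower : ℕ → Set
OddPrimePower q = Σ ℕ λ p → Σ ℕ λ k → Prime p × (p % 2 ≡ 1) × (1 ≤ k) × (q ≡ p ℕ^ k)

module Setup {c ℓ : Level} (F : CommutativeRing c ℓ) where
  open CommutativeRing F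
  open import Algebra.Definitions.RawSemiring (Semiring.rawSemiring semiring) public using (_^_)

  record IsFiniteFieldOfSize (n : ℕ) : Set (c Level.⊔ ℓ) where
    field
      nontrivial : ¬ (0# ≈ 1#)
      inverse    : ∀ x → ¬ (x ≈ 0#) → ∃ λ y → (x * y) ≈ 1#
      enum       : Fin n → Carrier
      enum-inj   : ∀ i j → enum i ≈ enum j → i ≡ j
      enum-surj  : ∀ x → ∃ λ i → enum i ≈ x

  record IsPrimitive (Q : ℕ) (α : Carrier) : Set ℓ where
    field
      order      : (α ^ (Q ∸ 1)) ≈ 1#
      minimal    : ∀ i → 0 < i → i < (Q ∸ 1) → ¬ ((α ^ i) ≈ 1#)

  module WithQ (q : ℕ) (α : Carrier) where
    Tr : Carrier → Carrier
    Tr x = x + (x ^ q) + (x ^ (q ℕ^ 2)) + (x ^ (q ℕ^ 3))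

    N : ℕ
    N = (q ℕ^ 2 ℕ+ 1) ℕ* (q ℕ+ 1)

    -- s ∈ D  (s taken as a representative in {0,…,N-1})
    InD : ℕ → Set ℓ
    InD s = (s < N) × (Tr (α ^ s) ≈ 0#)

    -- projective points of PG(3,q^4), given by a representative
    Point : Set c
    Point = Carrier × Carrier × Carrier × Carrier

    ω : ℕ → Point
    ω l = (α ^ l) , (α ^ (l ℕ* q)) , (α ^ (l ℕ* q ℕ^ 2)) , (α ^ (l ℕ* q ℕ^ 3))

    OnDiag : ℕ → Carrier → Point → Set ℓ
    OnDiag d e (x , y , z , t) =
      ((e * (x ^ d)) + (e ^ q) * (y ^ d) + (e ^ (q ℕ^ 2)) * (z ^ d) + (e ^ (q ℕ^ 3)) * (t ^ d)) ≈ 0#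

    OnP OnQ OnR : Carrier → Point → Set ℓ
    OnP = OnDiag 1
    OnQ = OnDiag 2
    OnR = OnDiag 4

    -- Ψ_a : (a√x + a^q√y + a^{q^2}√z + a^{q^3}√t)(a√x - a^q√y + a^{q^2}√z - a^{q^3}√t) = 0,
    -- evaluated with the given square roots (√x,√y,√z,√t)
    ΨProduct : Carrier → Point → Carrier
    ΨProduct a (sx , sy , sz , st) =
      ((a * sx) + (a ^ q) * sy + (a ^ (q ℕ^ 2)) * sz + (a ^ (q ℕ^ 3)) * st)
      * ((a * sx) - (a ^ q) * sy + (a ^ (q ℕ^ 2)) * sz - (a ^ (q ℕ^ 3)) * st)

    -- ω(2l(q+1)) ∈ Ψ_a, with (√x,√y,√z,√t) = (α^{l(q+1)}, α^{lq(q+1)}, α^{lq^2(q+1)}, α^{lq^3(q+1)}) = ω(l(q+1))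
    OnΨAt : Carrier → ℕ → Set ℓ
    OnΨAt a l = ΨProduct a (ω (l ℕ* (q ℕ+ 1))) ≈ 0#

{-# OPTIONS --safe #-}
module Submission where

-- Write q = 1 + 2k, K = (q⁴ - 1)/2 and E = (q² + 1)(q + 1)/2, so that E q = E + K.  As α is
-- primitive, α^K = -1; hence (α^E)^q = -α^E, while α^(2E) is fixed by the Frobenius x ↦ x^q.
-- The coordinates of ω(n) are the conjugates α^(n q^i), so adding a multiple of 2E to n scales
-- all four coordinates by one unit, which preserves every diagonal equation, whereas adding E
-- also flips the signs of the odd coordinates, which turns the first factor of Ψ_a into the
-- second.  Raising the coordinates of ω(n) to the d-th power gives ω(n d), and
-- (l + p m)(q + 1)·d differs from 2l(q + 1)·(d/2) by a multiple of 2E.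

open import Level using (Level)
open import Algebra.Bundles using (CommutativeRing)
open import Data.Product using (_×_; _,_; ∃-syntax)
open import Function using (_∘_)
open import Relation.Nullary using (¬_)
open import Defs

module Exponents where
  open import Data.Nat using (ℕ; zero; suc; _<_; _*_; _+_; _∸_; _^_; z≤n; s≤s)
  open import Data.Nat.Properties using (*-comm; *-assoc; *-distribˡ-+; *-identityʳ; m<m+n; m^n≡1⇒n≡0∨m≡1; <-irrefl)
  open import Data.Nat.DivMod using (_/_; _%_; m≡m%n+[m/n]*n; m*n/n≡m; %-distribˡ-*)
  open import Data.Nat.Primality using (prime⇒nonTrivial)
  open import Data.Nat.Base using (nonTrivial⇒≢1)
  open import Data.Nat.Tactic.RingSolver using (solve-∀; solve)
  open import Data.List using (_∷_; [])
  open import Data.Empty using (⊥-elim)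
  open import Data.Sum using ([_,_])
  open import Relation.Binary.PropositionalEquality using (_≡_; refl; sym; trans; cong; cong₂; module ≡-Reasoning)

  ^-%2≡1 : ∀ {p} → p % 2 ≡ 1 → ∀ k → p ^ k % 2 ≡ 1
  ^-%2≡1 p%2≡1 zero = refl
  ^-%2≡1 {p} p%2≡1 (suc k) = begin
    p * p ^ k % 2               ≡⟨ %-distribˡ-* p (p ^ k) 2 ⟩
    (p % 2) * (p ^ k % 2) % 2   ≡⟨ cong₂ (λ x y → x * y % 2) p%2≡1 (^-%2≡1 p%2≡1 k) ⟩
    1                           ∎
    where open ≡-Reasoning

  oddPrimePower⇒≡1+2*suc : ∀ {q} → OddPrimePower q → ∃[ b ] q ≡ 1 + 2 * suc b
  oddPrimePower⇒≡1+2*suc (p , k , p-prime , p%2≡1 , 1≤k , refl)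
    with p ^ k / 2 | m≡m%n+[m/n]*n (p ^ k) 2
  ... | zero  | p^k≡ = ⊥-elim ([ (λ k≡0 → <-irrefl (sym k≡0) 1≤k)
                              , nonTrivial⇒≢1 {{prime⇒nonTrivial p-prime}} ]
                              (m^n≡1⇒n≡0∨m≡1 p k (trans p^k≡ (cong (_+ 0) (^-%2≡1 p%2≡1 k)))))
  ... | suc b | p^k≡ = b , trans p^k≡ (cong₂ _+_ (^-%2≡1 p%2≡1 k) (*-comm (suc b) 2))

  -- q, m and K of OddExponents below, unfolded so that the ring solver can see through them.
  private
    q²+1≡m*2 : ∀ n → (1 + 2 * (1 + n)) * ((1 + 2 * (1 + n)) * 1) + 1 ≡ (1 + 2 * (1 + n) * (2 + n)) * 2
    q²+1≡m*2 = solve-∀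

    q⁴≡1+2*K : ∀ n → (1 + 2 * (1 + n)) * ((1 + 2 * (1 + n)) * ((1 + 2 * (1 + n)) * ((1 + 2 * (1 + n)) * 1)))
                   ≡ 1 + 2 * ((1 + 2 * (1 + n) * (2 + n)) * ((1 + 2 * (1 + n)) + 1) * (2 * (1 + n)))
    q⁴≡1+2*K = solve-∀

  module OddExponents (b : ℕ) where
    q m E K : ℕ
    q = 1 + 2 * suc b
    m = 1 + 2 * suc b * (2 + b)
    E = m * (q + 1)
    K = E * (2 * suc b)

    0<K : 0 < K
    0<K = s≤s z≤n

    K<2*K : K < 2 * K
    K<2*K = m<m+n K (s≤s z≤n)

    0<q⁴∸1 : 0 < q ^ 4 ∸ 1
    0<q⁴∸1 = s≤s z≤n

    [q²+1]/2≡m : (q ^ 2 + 1) / 2 ≡ m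
    [q²+1]/2≡m = trans (cong (_/ 2) (q²+1≡m*2 b)) (m*n/n≡m m 2)

    q⁴∸1≡2*K : q ^ 4 ∸ 1 ≡ 2 * K
    q⁴∸1≡2*K = cong (_∸ 1) (q⁴≡1+2*K b)

    E*q≡E+K : E * q ≡ E + K
    E*q≡E+K = trans (*-distribˡ-+ E 1 (2 * suc b)) (cong (_+ K) (*-identityʳ E))

    2E*q≡2E+2K : 2 * E * q ≡ 2 * E + 2 * K
    2E*q≡2E+2K = trans (*-assoc 2 E q) (trans (cong (2 *_) E*q≡E+K) (*-distribˡ-+ 2 E K))

  -- A * d ≡ B * d′ + G, wrapped in a record so that the five exponents can be inferred from a proof.
  record ExponentSplit (A d B d′ G : ℕ) : Set where
    constructor split
    field
      A*d≡B*d′+G : A * d ≡ B * d′ + G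

  exponentSplit-* : ∀ {A d B d′ G} → ExponentSplit A d B d′ G →
                    ∀ r → ExponentSplit (A * r) d (B * r) d′ (G * r)
  exponentSplit-* {A} {d} {B} {d′} {G} (split eq) r = split (begin
    A * r * d           ≡⟨ solve (A ∷ r ∷ d ∷ []) ⟩
    A * d * r           ≡⟨ cong (_* r) eq ⟩
    (B * d′ + G) * r    ≡⟨ solve (B ∷ d′ ∷ G ∷ r ∷ []) ⟩
    B * r * d′ + G * r  ∎)
    where open ≡-Reasoning

  exponent-P₀ : ∀ l m q →
    ExponentSplit ((l + 0 * m) * (q + 1)) 1 (l * (q + 1)) 1 (2 * (m * (q + 1)) * 0)
  exponent-P₀ l m q = split (solve (l ∷ m ∷ q ∷ []))

  exponent-P₁ : ∀ l m q →
    ExponentSplit ((l + 1 * m) * (q + 1)) 1 (l * (q + 1)) 1 (m * (q + 1))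
  exponent-P₁ l m q = split (solve (l ∷ m ∷ q ∷ []))

  exponent-Q : ∀ l j m q →
    ExponentSplit ((l + j * m) * (q + 1)) 2 (2 * l * (q + 1)) 1 (2 * (m * (q + 1)) * j)
  exponent-Q l j m q = split (solve (l ∷ j ∷ m ∷ q ∷ []))

  exponent-R : ∀ l j m q →
    ExponentSplit ((l + j * m) * (q + 1)) 4 (2 * l * (q + 1)) 2 (2 * (m * (q + 1)) * (2 * j))
  exponent-R l j m q = split (solve (l ∷ j ∷ m ∷ q ∷ []))

module _ {c ℓ : Level} (F : CommutativeRing c ℓ) where
  open import Data.Nat as ℕ using (ℕ; zero; suc; pred; _<_)
  import Data.Nat.Properties as ℕ
  open Exponents using (ExponentSplit; split; exponentSplit-*)
  open import Relation.Binary.PropositionalEquality as ≡ using (_≡_)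
  open CommutativeRing F
  open Setup F
  open import Algebra.Properties.Ring ring using (-1*x≈-x; -‿distribˡ-*; -‿distribʳ-*; -‿involutive; x∙y⁻¹≈ε⇒x≈y; +-inverseˡ-unique)
  open import Algebra.Properties.Semiring.Exp semiring using (^-congˡ; ^-congʳ; ^-homo-*; ^-assocʳ)
  open import Algebra.Properties.CommutativeSemiring.Exp commutativeSemiring using (^-distrib-*)
  open import Algebra.Solver.Ring.NaturalCoefficients.Default commutativeSemiring using (solve; _:+_; _:*_; _:=_)
  open import Relation.Binary.Reasoning.Setoid setoid

  1^n≈1 : ∀ n → 1# ^ n ≈ 1#
  1^n≈1 zero    = refl
  1^n≈1 (suc n) = trans (*-identityˡ _) (1^n≈1 n)

  ^-inverse : ∀ {x y} → y * x ≈ 1# → ∀ n → y ^ n * x ^ n ≈ 1#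
  ^-inverse {x} {y} yx≈1 n = begin
    y ^ n * x ^ n  ≈⟨ ^-distrib-* y x n ⟨
    (y * x) ^ n    ≈⟨ ^-congˡ n yx≈1 ⟩
    1# ^ n         ≈⟨ 1^n≈1 n ⟩
    1#             ∎

  ^-pred-inverse : ∀ {x n} → 0 < n → x ^ n ≈ 1# → x ^ pred n * x ≈ 1#
  ^-pred-inverse {x} {suc n} _ x^n≈1 = trans (*-comm (x ^ n) x) x^n≈1

  *-cancel-unit : ∀ {u δ s} → u * δ ≈ 1# → δ * s ≈ 0# → s ≈ 0#
  *-cancel-unit {u} {δ} {s} uδ≈1 δs≈0 = begin
    s            ≈⟨ *-identityˡ s ⟨
    1# * s       ≈⟨ *-congʳ uδ≈1 ⟨
    u * δ * s    ≈⟨ *-assoc u δ s ⟩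
    u * (δ * s)  ≈⟨ *-congˡ δs≈0 ⟩
    u * 0#       ≈⟨ zeroʳ u ⟩
    0#           ∎

  -1^odd : ∀ k → (- 1#) ^ (1 ℕ.+ 2 ℕ.* k) ≈ - 1#
  -1^odd k = begin
    - 1# * (- 1#) ^ (2 ℕ.* k)  ≈⟨ *-congˡ (^-assocʳ (- 1#) 2 k) ⟨
    - 1# * ((- 1#) ^ 2) ^ k    ≈⟨ *-congˡ (^-congˡ k [-1]²≈1) ⟩
    - 1# * 1# ^ k              ≈⟨ *-congˡ (1^n≈1 k) ⟩
    - 1# * 1#                  ≈⟨ *-identityʳ (- 1#) ⟩
    - 1#                       ∎
    where
    [-1]²≈1 : (- 1#) ^ 2 ≈ 1#
    [-1]²≈1 = trans (-1*x≈-x _) (trans (-‿cong (*-identityʳ (- 1#))) (-‿involutive 1#))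

  x²≈1⇒x≈-1 : ∀ {n x} → IsFiniteFieldOfSize n → x * x ≈ 1# → ¬ x ≈ 1# → x ≈ - 1#
  x²≈1⇒x≈-1 {x = x} isField x²≈1 x≉1
    with IsFiniteFieldOfSize.inverse isField (x - 1#) (x≉1 ∘ x∙y⁻¹≈ε⇒x≈y x 1#)
  ... | y , [x-1]y≈1 = +-inverseˡ-unique x 1# (*-cancel-unit y[x-1]≈1 [x-1][x+1]≈0)
    where
    y[x-1]≈1 : y * (x - 1#) ≈ 1#
    y[x-1]≈1 = trans (*-comm y (x - 1#)) [x-1]y≈1
    [x-1][x+1]≈0 : (x - 1#) * (x + 1#) ≈ 0#
    [x-1][x+1]≈0 = begin
      (x - 1#) * (x + 1#)
        ≈⟨ solve 3 (λ x n o → (x :+ n) :* (x :+ o) := (x :* x :+ n :* o) :+ x :* (n :+ o)) refl x (- 1#) 1# ⟩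
      (x * x + - 1# * 1#) + x * (- 1# + 1#)
        ≈⟨ +-cong (+-cong x²≈1 (*-identityʳ (- 1#))) (*-congˡ (-‿inverseˡ 1#)) ⟩
      (1# + - 1#) + x * 0#
        ≈⟨ +-cong (-‿inverseʳ 1#) (zeroʳ x) ⟩
      0# + 0#
        ≈⟨ +-identityʳ 0# ⟩
      0# ∎

  ^-split : ∀ x {A d B d′ G} → ExponentSplit A d B d′ G → (x ^ A) ^ d ≈ x ^ G * (x ^ B) ^ d′
  ^-split x {A} {d} {B} {d′} {G} (split eq) = begin
    (x ^ A) ^ d             ≈⟨ ^-assocʳ x A d ⟩
    x ^ (A ℕ.* d)           ≡⟨ ≡.cong (x ^_) eq ⟩
    x ^ (B ℕ.* d′ ℕ.+ G)    ≈⟨ ^-homo-* x (B ℕ.* d′) G ⟩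
    x ^ (B ℕ.* d′) * x ^ G  ≈⟨ *-comm _ _ ⟩
    x ^ G * x ^ (B ℕ.* d′)  ≈⟨ *-congˡ (^-assocʳ x B d′) ⟨
    x ^ G * (x ^ B) ^ d′    ∎

  ^-split-conjugate : ∀ x {A d B d′ G} → ExponentSplit A d B d′ G → ∀ r →
    (x ^ (A ℕ.* r)) ^ d ≈ (x ^ G) ^ r * (x ^ (B ℕ.* r)) ^ d′
  ^-split-conjugate x {G = G} eq r =
    trans (^-split x (exponentSplit-* eq r)) (*-congʳ (sym (^-assocʳ x G r)))

  [x^G]^q≈x^G*x^H : ∀ x {G q H} → G ℕ.* q ≡ G ℕ.+ H → (x ^ G) ^ q ≈ x ^ G * x ^ H
  [x^G]^q≈x^G*x^H x {G} {q} {H} eq = trans (^-assocʳ x G q) (trans (^-congʳ x eq) (^-homo-* x G H))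

  module Frobenius (q : ℕ) where
    Fixed Antifixed : Carrier → Set ℓ
    Fixed x     = x ^ q ≈ x
    Antifixed x = x ^ q ≈ - x

    fixed-resp : ∀ {x y} → x ≈ y → Fixed x → Fixed y
    fixed-resp {x} {y} x≈y fixed = trans (^-congˡ q (sym x≈y)) (trans fixed x≈y)

    fixed-^ : ∀ {x} → Fixed x → ∀ j → Fixed (x ^ j)
    fixed-^ {x} fixed j = begin
      (x ^ j) ^ q  ≈⟨ ^-assocʳ x j q ⟩
      x ^ (j ℕ.* q)  ≡⟨ ≡.cong (x ^_) (ℕ.*-comm j q) ⟩
      x ^ (q ℕ.* j)  ≈⟨ ^-assocʳ x q j ⟨
      (x ^ q) ^ j  ≈⟨ ^-congˡ j fixed ⟩
      x ^ j        ∎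

    fixed-^q^ : ∀ {x} → Fixed x → ∀ i → x ^ (q ℕ.^ i) ≈ x
    fixed-^q^ {x} fixed zero    = *-identityʳ x
    fixed-^q^ {x} fixed (suc i) = begin
      x ^ (q ℕ.* q ℕ.^ i)  ≈⟨ ^-assocʳ x q (q ℕ.^ i) ⟨
      (x ^ q) ^ (q ℕ.^ i)  ≈⟨ ^-congˡ (q ℕ.^ i) fixed ⟩
      x ^ (q ℕ.^ i)        ≈⟨ fixed-^q^ fixed i ⟩
      x                    ∎

    module _ (-1^q≈-1 : (- 1#) ^ q ≈ - 1#) where
      -‿^q : ∀ x → (- x) ^ q ≈ - x ^ q
      -‿^q x = begin
        (- x) ^ q            ≈⟨ ^-congˡ q (-1*x≈-x x) ⟨
        (- 1# * x) ^ q       ≈⟨ ^-distrib-* (- 1#) x q ⟩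
        (- 1#) ^ q * x ^ q   ≈⟨ *-congʳ -1^q≈-1 ⟩
        - 1# * x ^ q         ≈⟨ -1*x≈-x (x ^ q) ⟩
        - x ^ q              ∎

      antifixed-^q² : ∀ {x} → Antifixed x → x ^ (q ℕ.^ 2) ≈ x
      antifixed-^q² {x} antifixed = begin
        x ^ (q ℕ.* (q ℕ.* 1))  ≈⟨ ^-assocʳ x q (q ℕ.* 1) ⟨
        (x ^ q) ^ (q ℕ.* 1)    ≡⟨ ≡.cong ((x ^ q) ^_) (ℕ.*-identityʳ q) ⟩
        (x ^ q) ^ q            ≈⟨ ^-congˡ q antifixed ⟩
        (- x) ^ q              ≈⟨ -‿^q x ⟩
        - x ^ q                ≈⟨ -‿cong antifixed ⟩
        - - x                  ≈⟨ -‿involutive x ⟩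
        x                      ∎

      antifixed-^q³ : ∀ {x} → Antifixed x → x ^ (q ℕ.^ 3) ≈ - x
      antifixed-^q³ {x} antifixed = begin
        x ^ (q ℕ.^ 3)          ≡⟨ ≡.cong (x ^_) (ℕ.*-comm q (q ℕ.^ 2)) ⟩
        x ^ (q ℕ.^ 2 ℕ.* q)    ≈⟨ ^-assocʳ x (q ℕ.^ 2) q ⟨
        (x ^ (q ℕ.^ 2)) ^ q    ≈⟨ ^-congˡ q (antifixed-^q² antifixed) ⟩
        x ^ q                  ≈⟨ antifixed ⟩
        - x                    ∎

  module Points (q : ℕ) (α : Carrier) where
    open WithQ q α
    open Frobenius q

    onDiag-scale : ∀ d d′ {e u δ x₀ x₁ x₂ x₃ y₀ y₁ y₂ y₃} → u * δ ≈ 1# →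
      x₀ ^ d ≈ δ * y₀ ^ d′ → x₁ ^ d ≈ δ * y₁ ^ d′ → x₂ ^ d ≈ δ * y₂ ^ d′ → x₃ ^ d ≈ δ * y₃ ^ d′ →
      OnDiag d e (x₀ , x₁ , x₂ , x₃) → OnDiag d′ e (y₀ , y₁ , y₂ , y₃)
    onDiag-scale d d′ {e} {_} {δ} {x₀} {x₁} {x₂} {x₃} {y₀} {y₁} {y₂} {y₃} uδ≈1 h₀ h₁ h₂ h₃ onX =
      *-cancel-unit uδ≈1 (begin
        δ * (e₀ * w₀ + e₁ * w₁ + e₂ * w₂ + e₃ * w₃)
          ≈⟨ solve 9 (λ δ e₀ e₁ e₂ e₃ w₀ w₁ w₂ w₃ →
                        δ :* (e₀ :* w₀ :+ e₁ :* w₁ :+ e₂ :* w₂ :+ e₃ :* w₃)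
                     := e₀ :* (δ :* w₀) :+ e₁ :* (δ :* w₁) :+ e₂ :* (δ :* w₂) :+ e₃ :* (δ :* w₃))
                   refl δ e₀ e₁ e₂ e₃ w₀ w₁ w₂ w₃ ⟩
        e₀ * (δ * w₀) + e₁ * (δ * w₁) + e₂ * (δ * w₂) + e₃ * (δ * w₃)
          ≈⟨ +-cong (+-cong (+-cong (*-congˡ h₀) (*-congˡ h₁)) (*-congˡ h₂)) (*-congˡ h₃) ⟨
        e₀ * x₀ ^ d + e₁ * x₁ ^ d + e₂ * x₂ ^ d + e₃ * x₃ ^ d
          ≈⟨ onX ⟩
        0# ∎)
      where
      e₀ = e
      e₁ = e ^ q
      e₂ = e ^ (q ℕ.^ 2)
      e₃ = e ^ (q ℕ.^ 3)
      w₀ = y₀ ^ d′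
      w₁ = y₁ ^ d′
      w₂ = y₂ ^ d′
      w₃ = y₃ ^ d′

    twist : Point → Point
    twist (x , y , z , t) = (x , - y , z , - t)

    ΨProduct≈0-of-onP : ∀ {a} p → OnP a p → ΨProduct a p ≈ 0#
    ΨProduct≈0-of-onP {a} (x , y , z , t) onP = trans (*-congʳ firstFactor≈0) (zeroˡ _)
      where
      firstFactor≈0 : a * x + a ^ q * y + a ^ (q ℕ.^ 2) * z + a ^ (q ℕ.^ 3) * t ≈ 0#
      firstFactor≈0 = trans (sym (+-cong (+-cong (+-cong (*-congˡ (*-identityʳ x))
                                                         (*-congˡ (*-identityʳ y)))
                                                 (*-congˡ (*-identityʳ z)))
                                         (*-congˡ (*-identityʳ t))))
                            onP

    ΨProduct≈0-of-twist : ∀ {a} p → OnP a (twist p) → ΨProduct a p ≈ 0#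
    ΨProduct≈0-of-twist {a} (x , y , z , t) onP = trans (*-congˡ secondFactor≈0) (zeroʳ _)
      where
      -‿coordinate : ∀ b w → - (b * w) ≈ b * (- w) ^ 1
      -‿coordinate b w = trans (-‿distribʳ-* b w) (*-congˡ (sym (*-identityʳ (- w))))
      secondFactor≈0 : a * x - a ^ q * y + a ^ (q ℕ.^ 2) * z - a ^ (q ℕ.^ 3) * t ≈ 0#
      secondFactor≈0 = trans (+-cong (+-cong (+-cong (*-congˡ (sym (*-identityʳ x)))
                                                     (-‿coordinate (a ^ q) y))
                                             (*-congˡ (sym (*-identityʳ z))))
                                     (-‿coordinate (a ^ (q ℕ.^ 3)) t))
                             onP

    module _ {α⁻¹ : Carrier} (α⁻¹*α≈1 : α⁻¹ * α ≈ 1#) where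
      ω-transfer : ∀ {A d B d′ G e} → Fixed (α ^ G) → ExponentSplit A d B d′ G →
        OnDiag d e (ω A) → OnDiag d′ e (ω B)
      ω-transfer {A} {d} {B} {d′} {G} fixed eq =
        onDiag-scale d d′ (^-inverse α⁻¹*α≈1 G) (^-split α eq)
          (conjugate q fixed)
          (conjugate (q ℕ.^ 2) (fixed-^q^ fixed 2))
          (conjugate (q ℕ.^ 3) (fixed-^q^ fixed 3))
        where
        conjugate : ∀ r → (α ^ G) ^ r ≈ α ^ G → (α ^ (A ℕ.* r)) ^ d ≈ α ^ G * (α ^ (B ℕ.* r)) ^ d′
        conjugate r fixedʳ = trans (^-split-conjugate α eq r) (*-congʳ fixedʳ)

      ω-twist : ∀ {A B E e} → (- 1#) ^ q ≈ - 1# → Antifixed (α ^ E) → ExponentSplit A 1 B 1 E →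
        OnP e (ω A) → OnP e (twist (ω B))
      ω-twist {A} {B} {E} -1^q≈-1 antifixed eq =
        onDiag-scale 1 1 (^-inverse α⁻¹*α≈1 E) (^-split α eq)
          (negated (conjugate q antifixed))
          (conjugate (q ℕ.^ 2) (antifixed-^q² -1^q≈-1 antifixed))
          (negated (conjugate (q ℕ.^ 3) (antifixed-^q³ -1^q≈-1 antifixed)))
        where
        conjugate : ∀ r {σ} → (α ^ E) ^ r ≈ σ → (α ^ (A ℕ.* r)) ^ 1 ≈ σ * (α ^ (B ℕ.* r)) ^ 1
        conjugate r σ≈ = trans (^-split-conjugate α eq r) (*-congʳ σ≈)
        negated : ∀ {w δ y} → w ≈ - δ * y ^ 1 → w ≈ δ * (- y) ^ 1
        negated {w} {δ} {y} w≈ = begin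
          w                 ≈⟨ w≈ ⟩
          - δ * (y * 1#)    ≈⟨ -‿distribˡ-* δ (y * 1#) ⟨
          - (δ * (y * 1#))  ≈⟨ -‿distribʳ-* δ (y * 1#) ⟩
          δ * - (y * 1#)    ≈⟨ *-congˡ (-‿distribˡ-* y 1#) ⟩
          δ * (- y * 1#)    ∎

  module PrimitiveElement (b : ℕ) {n} (isField : IsFiniteFieldOfSize n)
    {α : Carrier} (isPrimitive : IsPrimitive ((1 ℕ.+ 2 ℕ.* suc b) ℕ.^ 4) α) where
    open Exponents.OddExponents b
    open Frobenius q
    open IsPrimitive isPrimitive

    α^2K≈1 : α ^ (2 ℕ.* K) ≈ 1#
    α^2K≈1 = trans (^-congʳ α (≡.sym q⁴∸1≡2*K)) order

    α^K≈-1 : α ^ K ≈ - 1#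
    α^K≈-1 = x²≈1⇒x≈-1 isField α^K*α^K≈1
               (minimal K 0<K (≡.subst (K ℕ.<_) (≡.sym q⁴∸1≡2*K) K<2*K))
      where
      α^K*α^K≈1 : α ^ K * α ^ K ≈ 1#
      α^K*α^K≈1 = begin
        α ^ K * α ^ K         ≈⟨ ^-homo-* α K K ⟨
        α ^ (K ℕ.+ K)         ≡⟨ ≡.cong (α ^_) (≡.cong (K ℕ.+_) (≡.sym (ℕ.+-identityʳ K))) ⟩
        α ^ (2 ℕ.* K)         ≈⟨ α^2K≈1 ⟩
        1#                    ∎

    α⁻¹*α≈1 : α ^ pred (q ℕ.^ 4 ℕ.∸ 1) * α ≈ 1#
    α⁻¹*α≈1 = ^-pred-inverse 0<q⁴∸1 order

    antifixed-α^E : Antifixed (α ^ E)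
    antifixed-α^E = begin
      (α ^ E) ^ q     ≈⟨ [x^G]^q≈x^G*x^H α {E} {q} {K} E*q≡E+K ⟩
      α ^ E * α ^ K   ≈⟨ *-congˡ α^K≈-1 ⟩
      α ^ E * - 1#    ≈⟨ -‿distribʳ-* (α ^ E) 1# ⟨
      - (α ^ E * 1#)  ≈⟨ -‿cong (*-identityʳ (α ^ E)) ⟩
      - α ^ E         ∎

    fixed-α^[2E*j] : ∀ j → Fixed (α ^ (2 ℕ.* E ℕ.* j))
    fixed-α^[2E*j] j = fixed-resp (^-assocʳ α (2 ℕ.* E) j) (fixed-^ fixed-α^2E j)
      where
      fixed-α^2E : Fixed (α ^ (2 ℕ.* E))
      fixed-α^2E = begin
        (α ^ (2 ℕ.* E)) ^ q              ≈⟨ [x^G]^q≈x^G*x^H α {2 ℕ.* E} {q} {2 ℕ.* K} 2E*q≡2E+2K ⟩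
        α ^ (2 ℕ.* E) * α ^ (2 ℕ.* K)    ≈⟨ *-congˡ α^2K≈1 ⟩
        α ^ (2 ℕ.* E) * 1#               ≈⟨ *-identityʳ _ ⟩
        α ^ (2 ℕ.* E)                    ∎

open import Data.Nat using (ℕ; suc; _<_; _≤_; _*_; _+_; _^_; z≤n; s≤s)
open import Data.Nat.DivMod using (_/_)
open import Relation.Binary.PropositionalEquality using (_≢_; refl)
open Exponents using (oddPrimePower⇒≡1+2*suc; module OddExponents; exponent-P₀; exponent-P₁; exponent-Q; exponent-R)

mainTheorem20 : ∀ {c ℓ : Level} (F : CommutativeRing c ℓ) (q : ℕ) → OddPrimePower q →
    Setup.IsFiniteFieldOfSize F (q ^ 4) →
    (α : CommutativeRing.Carrier F) → Setup.IsPrimitive F (q ^ 4) α →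
    let open Setup F using (module WithQ) renaming (_^_ to _^F_) in let open WithQ q α in
    (s u v : ℕ) → InD s → InD u → InD v →
    s ≢ N / 2 → u ≢ N / 2 → v ≢ N / 2 →
    (l : ℕ) → l < (q ^ 2 + 1) / 2 → (pl : ℕ) → pl ≤ 1 →
    (OnP (α ^F s) (ω ((l + pl * ((q ^ 2 + 1) / 2)) * (q + 1))) → OnΨAt (α ^F s) l)
    × (OnQ (α ^F u) (ω ((l + pl * ((q ^ 2 + 1) / 2)) * (q + 1))) → OnP (α ^F u) (ω (2 * l * (q + 1))))
    × (OnR (α ^F v) (ω ((l + pl * ((q ^ 2 + 1) / 2)) * (q + 1))) → OnQ (α ^F v) (ω (2 * l * (q + 1))))
mainTheorem20 F _ oddPrimePower isField α isPrimitive s u v _ _ _ _ _ _ l _ pl pl≤1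
  with oddPrimePower⇒≡1+2*suc oddPrimePower
... | b , refl rewrite OddExponents.[q²+1]/2≡m b =
  onΨ pl≤1 ,
  ω-transfer α⁻¹*α≈1 (fixed-α^[2E*j] pl) (exponent-Q l pl m q) ,
  ω-transfer α⁻¹*α≈1 (fixed-α^[2E*j] (2 * pl)) (exponent-R l pl m q)
  where
  open OddExponents b
  open Points F q α
  open PrimitiveElement F b isField isPrimitive
  open Setup F using (module WithQ)
  open WithQ q α using (OnP; OnΨAt; ω)
  onΨ : ∀ {a pl} → pl ≤ 1 → OnP a (ω ((l + pl * m) * (q + 1))) → OnΨAt a l
  onΨ z≤n       = ΨProduct≈0-of-onP (ω (l * (q + 1)))
                ∘ ω-transfer α⁻¹*α≈1 (fixed-α^[2E*j] 0) (exponent-P₀ l m q)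
  onΨ (s≤s z≤n) = ΨProduct≈0-of-twist (ω (l * (q + 1)))
                ∘ ω-twist α⁻¹*α≈1 (-1^odd F (suc b)) antifixed-α^E (exponent-P₁ l m q)
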